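{- Let $V=\{v_1\succ v_2\succ\cdots\succ v_N\}$ be a finite totally ordered set, $a\le N$ a positive integer, and $X=\{x_1\succ x_2\succ\cdots\succ x_{N-a}\}$ a set of variables. Let $\tau,\tau'$ be $a$-subsets of $V$ with $\mu=\phi(V,X)(\tau)$ and $\mu'=\phi(V,X)(\tau')$. If $\tau'\succ\tau$ and $\deg(\mu')\le\deg(\mu)$, then there is a divisor $\mu''$ of $\mu$ such that $\deg(\mu'')=\deg(\mu')$ and $\mu'\succeq\mu''$.
   Context: The map $\phi(V,X)$: every $a$-subset $\tau$ of $V$ can be written uniquely as $\tau=\{v_1,\ldots,v_t,v_{i_1},\ldots,v_{i_s}\}$ with $t,s\ge0$, $t+s=a$, $t+1<i_1<i_2<\cdots<i_s$; then $\phi(V,X)(\tau)=x_{i_1-(t+1)}x_{i_2-(t+2)}\cdots x_{i_s-(t+s)}$. Revlex order on $a$-subsets: $S\succ T$ if the $\succ$-least element of the symmetric difference lies in $T$. Revlex order on monomials of equal degree: $\mu_1\succ\mu_2$ if the $\succ$-least variable in $\mu_1/\mu_2$ has negative exponent; $\succeq$ means $\succ$ or equal. -}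

module Defs where

open import Data.Nat using (ℕ; zero; suc; _+_; _∸_; _<_; _≤_; _≟_)
open import Data.Bool using (Bool; true; false)
open import Data.Vec using (Vec; []; _∷_)
open import Data.Fin using (Fin; toℕ)
open import Data.Fin.Subset using (Subset; _∈_; _∉_)
open import Data.List using (List; []; _∷_; drop; map; allFin; length; filter)
open import Data.Nat.ListAction using (sum)
open import Data.Product using (Σ; _×_)
open import Data.Sum using (_⊎_)
open import Function.Bundles using (_⇔_)
open import Relation.Binary.PropositionalEquality using (_≡_)

-- V = {v_1 ≻ ... ≻ v_N} is modelled by Fin N, with v_i ↔ the element of
-- Fin N with toℕ = i - 1.  Hence v_i ≻ v_j iff i < j (smaller index is larger).
-- An a-subset of V is a  τ : Subset N  with  ∣ τ ∣ ≡ a.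

posFrom : ∀ {n} → ℕ → Vec Bool n → List ℕ
posFrom i [] = []
posFrom i (true ∷ p) = i ∷ posFrom (suc i) p
posFrom i (false ∷ p) = posFrom (suc i) p

positions : ∀ {n} → Subset n → List ℕ
positions = posFrom 1

-- t : the length of the initial run v_1, ..., v_t contained in τ
-- (this is the unique t with t+1 < i_1 in the decomposition of τ).
initRun : ∀ {n} → Subset n → ℕ
initRun [] = 0
initRun (true ∷ p) = suc (initRun p)
initRun (false ∷ p) = 0

varIdx : ℕ → ℕ → List ℕ → List ℕ
varIdx t k [] = []
varIdx t k (i ∷ is) = (i ∸ (t + k)) ∷ varIdx t (suc k) is

-- the (1-based) indices of the variables in φ(V,X)(τ), with multiplicity:
-- i_1 - (t+1), ..., i_s - (t+s)
phiIndices : ∀ {n} → Subset n → List ℕ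
phiIndices τ = varIdx (initRun τ) 1 (drop (initRun τ) (positions τ))

-- Monomials in X = {x_1 ≻ ... ≻ x_m}: exponent vectors; the exponent of
-- x_j is the value at the element of Fin m with toℕ = j - 1.
Monomial : ℕ → Set
Monomial m = Fin m → ℕ

φ : (N a : ℕ) → Subset N → Monomial (N ∸ a)
φ N a τ k = length (filter (λ j → j ≟ suc (toℕ k)) (phiIndices τ))

deg : ∀ {m} → Monomial m → ℕ
deg {m} μ = sum (map μ (allFin m))

_∣ₘ_ : ∀ {m} → Monomial m → Monomial m → Set
μ'' ∣ₘ μ = ∀ k → μ'' k ≤ μ k

-- Revlex on monomials: μ₁ ≻ μ₂ iff the ≻-least variable (largest index)
-- with nonzero exponent in μ₁/μ₂ has negative exponent.
_≻ₘ_ : ∀ {m} → Monomial m → Monomial m → Set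
_≻ₘ_ {m} μ₁ μ₂ = Σ (Fin m) λ k → (μ₁ k < μ₂ k) × (∀ j → toℕ k < toℕ j → μ₁ j ≡ μ₂ j)

_⪰ₘ_ : ∀ {m} → Monomial m → Monomial m → Set
μ₁ ⪰ₘ μ₂ = (μ₁ ≻ₘ μ₂) ⊎ (∀ k → μ₁ k ≡ μ₂ k)

-- Revlex on subsets: S ≻ T iff the ≻-least element (largest index) of the
-- symmetric difference S △ T lies in T.
_≻ₛ_ : ∀ {n} → Subset n → Subset n → Set
_≻ₛ_ {n} S T = Σ (Fin n) λ i → (i ∈ T) × (i ∉ S) × (∀ j → toℕ i < toℕ j → (j ∈ S ⇔ j ∈ T))

-- The gap of an element of τ is the number of elements of V ∖ τ above it, and φ(τ) is the
-- product of x_g over the positive gaps g of the elements of τ.  Let v_i be the pivot of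
-- τ' ≻ τ (the ≻-least element of the symmetric difference; it lies in τ).  Below v_i the two
-- subsets agree, and |τ| = |τ'| forces the gap of v_i in τ to be y + 1, where y is the number
-- of non-elements of τ' above v_i; so the elements below v_i have the same gaps in τ and τ'.
-- Hence μ = α x_{y+1} γ and μ' = β γ, where α only involves x_1, …, x_{y+1} and β only
-- x_1, …, x_y.  If deg μ' ≤ deg γ then β = 1 and μ'' = μ' = γ divides μ.  Otherwise take
-- μ'' = ν x_{y+1} γ with ν ∣ α of degree deg μ' − deg γ − 1: it agrees with μ' on the
-- variables after x_{y+1} and has the larger exponent at x_{y+1}, so μ' ≻ μ''.
module Submission where

open import Defs
open import Data.Bool using (true; false)
open import Data.Fin using (Fin; toℕ; zero; suc; fromℕ<)
open import Data.Fin.Properties using (toℕ-injective; toℕ-fromℕ<) renaming (_≟_ to _≟ᶠ_)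
open import Data.Fin.Subset using (Subset; _∈_; _∉_; ∣_∣; ∁)
open import Data.Fin.Subset.Properties using (drop-there; ⊆-antisym; ∣∁p∣≡n∸∣p∣)
open import Data.List using (List; []; _∷_; _++_; map; filter; length; allFin; drop)
open import Data.List.Properties
  using (map-cong; map-tabulate; filter-++; length-++; filter-none; filter-accept; filter-reject)
open import Data.List.Relation.Unary.All using (All; []; _∷_)
import Data.List.Relation.Unary.All as All
open import Data.List.Relation.Unary.All.Properties using (++⁻ʳ)
open import Data.Nat using (ℕ; zero; suc; _+_; _∸_; _⊓_; _<_; _≤_; _≟_; z≤n; s≤s; _≤?_)
open import Data.Nat.ListAction using (sum)
open import Data.Nat.Properties hiding (_≟_)
open import Algebra.Properties.CommutativeSemigroup +-commutativeSemigroup using (interchange; xy∙z≈xz∙y)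
open import Data.Product using (Σ; _×_; _,_; proj₁; proj₂)
open import Data.Sum using (inj₁; inj₂)
open import Data.Vec using ([]; _∷_; here; there)
open import Function using (_∘_; id)
open import Function.Bundles using (_⇔_; mk⇔; Equivalence)
open import Relation.Binary.PropositionalEquality
open import Relation.Nullary using (yes; no; contradiction)

_*ₘ_ : ∀ {m} → Monomial m → Monomial m → Monomial m
(μ *ₘ ν) k = μ k + ν k

var : ∀ {m} → Fin m → Monomial m
var zero    zero    = 1
var zero    (suc _) = 0
var (suc _) zero    = 0
var (suc k) (suc j) = var k j

var-diagonal : ∀ {m} (k : Fin m) → var k k ≡ 1
var-diagonal zero    = refl
var-diagonal (suc k) = var-diagonal k

var-off-diagonal : ∀ {m} {k j : Fin m} → j ≢ k → var k j ≡ 0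
var-off-diagonal {k = zero}  {zero}  j≢k = contradiction refl j≢k
var-off-diagonal {k = zero}  {suc j} j≢k = refl
var-off-diagonal {k = suc k} {zero}  j≢k = refl
var-off-diagonal {k = suc k} {suc j} j≢k = var-off-diagonal (j≢k ∘ cong suc)

deg-suc : ∀ {m} (μ : Monomial (suc m)) → deg μ ≡ μ zero + deg (μ ∘ suc)
deg-suc μ = cong (λ xs → μ zero + sum xs)
  (trans (map-tabulate suc μ) (sym (map-tabulate id (μ ∘ suc))))

deg-cong : ∀ {m} {μ ν : Monomial m} → (∀ k → μ k ≡ ν k) → deg μ ≡ deg ν
deg-cong {m} μ≗ν = cong sum (map-cong μ≗ν (allFin m))

sum-map-+ : ∀ {A : Set} (f g : A → ℕ) (xs : List A) →
  sum (map (λ x → f x + g x) xs) ≡ sum (map f xs) + sum (map g xs)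
sum-map-+ f g []       = refl
sum-map-+ f g (x ∷ xs) = trans (cong (f x + g x +_) (sum-map-+ f g xs))
  (interchange (f x) (g x) (sum (map f xs)) (sum (map g xs)))

deg-*ₘ : ∀ {m} (μ ν : Monomial m) → deg (μ *ₘ ν) ≡ deg μ + deg ν
deg-*ₘ {m} μ ν = sum-map-+ μ ν (allFin m)

deg-var : ∀ {m} (k : Fin m) → deg (var k) ≡ 1
deg-var {suc m} zero    = trans (deg-suc (var {suc m} zero)) (cong suc (deg-zero m))
  where
  deg-zero : ∀ m → deg {m} (λ _ → 0) ≡ 0
  deg-zero zero    = refl
  deg-zero (suc m) = trans (deg-suc {m} (λ _ → 0)) (deg-zero m)
deg-var {suc m} (suc k) = trans (deg-suc (var (suc k))) (deg-var k)

exponent≤deg : ∀ {m} (μ : Monomial m) k → μ k ≤ deg μ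
exponent≤deg μ zero    = ≤-trans (m≤m+n (μ zero) _) (≤-reflexive (sym (deg-suc μ)))
exponent≤deg μ (suc k) =
  ≤-trans (≤-trans (exponent≤deg (μ ∘ suc) k) (m≤n+m _ (μ zero))) (≤-reflexive (sym (deg-suc μ)))

divisor-of-degree : ∀ {m} (μ : Monomial m) n → n ≤ deg μ →
  Σ (Monomial m) λ ν → (ν ∣ₘ μ) × (deg ν ≡ n)
divisor-of-degree {zero}  μ n n≤0 = μ , (λ ()) , sym (n≤0⇒n≡0 n≤0)
divisor-of-degree {suc m} μ n n≤deg = ν' , ν'∣μ , deg-ν'
  where
  rest : Σ (Monomial m) λ ν → (ν ∣ₘ (μ ∘ suc)) × (deg ν ≡ n ∸ μ zero)
  rest = divisor-of-degree (μ ∘ suc) (n ∸ μ zero)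
           (m≤n+o⇒m∸n≤o n (μ zero) (subst (n ≤_) (deg-suc μ) n≤deg))
  ν' : Monomial (suc m)
  ν' zero    = μ zero ⊓ n
  ν' (suc k) = proj₁ rest k
  ν'∣μ : ν' ∣ₘ μ
  ν'∣μ zero    = m⊓n≤m (μ zero) n
  ν'∣μ (suc k) = proj₁ (proj₂ rest) k
  deg-ν' : deg ν' ≡ n
  deg-ν' = trans (deg-suc ν')
    (trans (cong (μ zero ⊓ n +_) (proj₂ (proj₂ rest))) (m⊓n+n∸m≡n (μ zero) n))

revlex-divisor : ∀ {m} (α β γ : Monomial m) (k : Fin m) {μ μ' : Monomial m} →
  (∀ j → μ j ≡ (α *ₘ (var k *ₘ γ)) j) → (∀ j → μ' j ≡ (β *ₘ γ) j) →
  (∀ j → toℕ k < toℕ j → α j ≡ 0) → (∀ j → toℕ k ≤ toℕ j → β j ≡ 0) →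
  deg μ' ≤ deg μ →
  Σ (Monomial m) λ μ'' → (μ'' ∣ₘ μ) × (deg μ'' ≡ deg μ') × (μ' ⪰ₘ μ'')
revlex-divisor {m} α β γ k {μ} {μ'} μ≗ μ'≗ α-above β-above deg≤ with deg μ' ≤? deg γ
... | yes deg≤γ = μ' , μ'∣μ , refl , inj₂ (λ _ → refl)
  where
  β-trivial : ∀ j → β j ≡ 0
  β-trivial j = n≤0⇒n≡0 (≤-trans (exponent≤deg β j) (+-cancelʳ-≤ (deg γ) (deg β) 0
    (subst (_≤ deg γ) (trans (deg-cong μ'≗) (deg-*ₘ β γ)) deg≤γ)))
  μ'∣μ : μ' ∣ₘ μ
  μ'∣μ j = subst₂ _≤_ (sym (trans (μ'≗ j) (cong (_+ γ j) (β-trivial j)))) (sym (μ≗ j))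
    (≤-trans (m≤n+m (γ j) (var k j)) (m≤n+m _ (α j)))
... | no deg≰γ = ν *ₘ (var k *ₘ γ) , μ''∣μ , deg-μ'' , inj₁ (k , at-k , above-k)
  where
  deg-μ : deg μ ≡ deg α + suc (deg γ)
  deg-μ = begin
    deg μ                          ≡⟨ deg-cong μ≗ ⟩
    deg (α *ₘ (var k *ₘ γ))        ≡⟨ deg-*ₘ α (var k *ₘ γ) ⟩
    deg α + deg (var k *ₘ γ)       ≡⟨ cong (deg α +_) (deg-*ₘ (var k) γ) ⟩
    deg α + (deg (var k) + deg γ)  ≡⟨ cong (λ d → deg α + (d + deg γ)) (deg-var k) ⟩
    deg α + suc (deg γ)            ∎
    where open ≡-Reasoning
  n : ℕ
  n = deg μ' ∸ suc (deg γ)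
  divisor : Σ (Monomial m) λ ν → (ν ∣ₘ α) × (deg ν ≡ n)
  divisor = divisor-of-degree α n (m≤n+o⇒m∸n≤o (deg μ') (suc (deg γ))
    (subst (deg μ' ≤_) (trans deg-μ (+-comm (deg α) _)) deg≤))
  ν : Monomial m
  ν = proj₁ divisor
  ν∣α : ν ∣ₘ α
  ν∣α = proj₁ (proj₂ divisor)
  μ''∣μ : (ν *ₘ (var k *ₘ γ)) ∣ₘ μ
  μ''∣μ j = subst ((ν *ₘ (var k *ₘ γ)) j ≤_) (sym (μ≗ j))
    (+-monoˡ-≤ (var k j + γ j) (ν∣α j))
  deg-μ'' : deg (ν *ₘ (var k *ₘ γ)) ≡ deg μ'
  deg-μ'' = begin
    deg (ν *ₘ (var k *ₘ γ))        ≡⟨ deg-*ₘ ν (var k *ₘ γ) ⟩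
    deg ν + deg (var k *ₘ γ)       ≡⟨ cong₂ _+_ (proj₂ (proj₂ divisor)) (deg-*ₘ (var k) γ) ⟩
    n + (deg (var k) + deg γ)      ≡⟨ cong (λ d → n + (d + deg γ)) (deg-var k) ⟩
    n + suc (deg γ)                ≡⟨ m∸n+n≡m (≰⇒> deg≰γ) ⟩
    deg μ'                         ∎
    where open ≡-Reasoning
  at-k : μ' k < (ν *ₘ (var k *ₘ γ)) k
  at-k = subst₂ _<_ (sym (trans (μ'≗ k) (cong (_+ γ k) (β-above k ≤-refl))))
    (cong (λ e → ν k + (e + γ k)) (sym (var-diagonal k))) (m≤n+m (suc (γ k)) (ν k))
  above-k : ∀ j → toℕ k < toℕ j → μ' j ≡ (ν *ₘ (var k *ₘ γ)) j
  above-k j k<j = begin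
    μ' j                    ≡⟨ μ'≗ j ⟩
    β j + γ j               ≡⟨ cong (_+ γ j) (β-above j (<⇒≤ k<j)) ⟩
    γ j                     ≡⟨ cong₂ (λ e f → e + (f + γ j)) ν-j var-j ⟩
    ν j + (var k j + γ j)   ∎
    where
    open ≡-Reasoning
    ν-j : 0 ≡ ν j
    ν-j = sym (n≤0⇒n≡0 (subst (ν j ≤_) (α-above j k<j) (ν∣α j)))
    var-j : 0 ≡ var k j
    var-j = sym (var-off-diagonal (λ j≡k → <⇒≢ k<j (cong toℕ (sym j≡k))))

multiplicity : ℕ → List ℕ → ℕ
multiplicity v L = length (filter (_≟ v) L)

-- The product of x_e over the entries e of L; entries 0 and entries beyond m are dropped.
monomial : ∀ {m} → List ℕ → Monomial m
monomial L k = multiplicity (suc (toℕ k)) L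

monomial-++ : ∀ {m} L M (k : Fin m) → monomial (L ++ M) k ≡ (monomial L *ₘ monomial M) k
monomial-++ L M k = trans (cong length (filter-++ (_≟ suc (toℕ k)) L M))
  (length-++ (filter (_≟ suc (toℕ k)) L))

monomial-var : ∀ {m} (k j : Fin m) → monomial (suc (toℕ k) ∷ []) j ≡ var k j
monomial-var k j with j ≟ᶠ k
... | yes refl = trans (cong length (filter-accept (_≟ suc (toℕ j)) refl)) (sym (var-diagonal j))
... | no j≢k   = trans (cong length (filter-reject (_≟ suc (toℕ j)) k≢j)) (sym (var-off-diagonal j≢k))
  where
  k≢j : suc (toℕ k) ≢ suc (toℕ j)
  k≢j = j≢k ∘ toℕ-injective ∘ suc-injective ∘ sym

monomial-++-var : ∀ {m} L (k : Fin m) M j →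
  monomial (L ++ suc (toℕ k) ∷ M) j ≡ (monomial L *ₘ (var k *ₘ monomial M)) j
monomial-++-var L k M j = begin
  monomial (L ++ x ∷ M) j                        ≡⟨ monomial-++ L (x ∷ M) j ⟩
  monomial L j + monomial (x ∷ M) j              ≡⟨ cong (monomial L j +_) (monomial-++ (x ∷ []) M j) ⟩
  monomial L j + (monomial (x ∷ []) j + monomial M j)
    ≡⟨ cong (λ e → monomial L j + (e + monomial M j)) (monomial-var k j) ⟩
  monomial L j + (var k j + monomial M j)        ∎
  where
  open ≡-Reasoning
  x : ℕ
  x = suc (toℕ k)

monomial-vanishes : ∀ {m} {b} L → All (_≤ b) L → (j : Fin m) → b ≤ toℕ j → monomial L j ≡ 0
monomial-vanishes L L≤b j b≤j = cong length (filter-none (_≟ suc (toℕ j))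
  (All.map (λ e≤b → <⇒≢ (s≤s (≤-trans e≤b b≤j))) L≤b))

gapsFrom : ∀ {n} → ℕ → Subset n → List ℕ
gapsFrom g []          = []
gapsFrom g (true ∷ p)  = g ∷ gapsFrom g p
gapsFrom g (false ∷ p) = gapsFrom (suc g) p

varIdx-posFrom : ∀ {n} t k i g (p : Subset n) → i ≡ g + (t + k) →
  varIdx t k (posFrom i p) ≡ gapsFrom g p
varIdx-posFrom t k i g []          i≡ = refl
varIdx-posFrom t k i g (true ∷ p)  i≡ = cong₂ _∷_
  (trans (cong (_∸ (t + k)) i≡) (m+n∸n≡m g (t + k)))
  (varIdx-posFrom t (suc k) (suc i) g p
    (trans (cong suc i≡) (trans (sym (+-suc g (t + k))) (cong (g +_) (sym (+-suc t k))))))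
varIdx-posFrom t k i g (false ∷ p) i≡ = varIdx-posFrom t k (suc i) (suc g) p (cong suc i≡)

-- The initial run v₁ … v_t of τ has gap 0, which x-indices never match.
monomial-phiIndices : ∀ {m n} (τ : Subset n) (k : Fin m) →
  monomial (phiIndices τ) k ≡ monomial (gapsFrom 0 τ) k
monomial-phiIndices τ k = past-initial-run τ 0 refl
  where
  t : ℕ
  t = initRun τ
  past-initial-run : ∀ {n} (p : Subset n) j → j + initRun p ≡ t →
    monomial (varIdx t 1 (drop (initRun p) (posFrom (suc j) p))) k ≡ monomial (gapsFrom 0 p) k
  past-initial-run []          j _     = refl
  past-initial-run (true ∷ p)  j j+r≡t =
    past-initial-run p (suc j) (trans (sym (+-suc j (initRun p))) j+r≡t)
  past-initial-run (false ∷ p) j j≡t   = cong (λ L → monomial L k)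
    (varIdx-posFrom t 1 (suc (suc j)) 1 p (cong suc (trans (+-comm 1 j) (cong (_+ 1) (trans (sym (+-identityʳ j)) j≡t)))))

gapsFrom-≤ : ∀ {n} g (p : Subset n) → All (_≤ g + ∣ ∁ p ∣) (gapsFrom g p)
gapsFrom-≤ g []          = []
gapsFrom-≤ g (true ∷ p)  = m≤m+n g _ ∷ gapsFrom-≤ g p
gapsFrom-≤ g (false ∷ p) =
  All.map (λ le → ≤-trans le (≤-reflexive (sym (+-suc g _)))) (gapsFrom-≤ (suc g) p)

≻ₛ-tail : ∀ {n b b'} {p p' : Subset n} (i : Fin n) → suc i ∈ b ∷ p → suc i ∉ b' ∷ p' →
  (∀ j → toℕ (suc i) < toℕ j → (j ∈ b' ∷ p' ⇔ j ∈ b ∷ p)) → p' ≻ₛ p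
≻ₛ-tail i i∈p i∉p' agree = i , drop-there i∈p , i∉p' ∘ there , λ j i<j →
  mk⇔ (drop-there ∘ Equivalence.to (agree (suc j) (s≤s i<j)) ∘ there)
      (drop-there ∘ Equivalence.from (agree (suc j) (s≤s i<j)) ∘ there)

agree-tail : ∀ {n b b'} {p p' : Subset n} → (∀ j → 0 < toℕ j → (j ∈ b' ∷ p' ⇔ j ∈ b ∷ p)) → p' ≡ p
agree-tail agree = ⊆-antisym
  (λ {j} j∈p' → drop-there (Equivalence.to (agree (suc j) (s≤s z≤n)) (there j∈p')))
  (λ {j} j∈p → drop-there (Equivalence.from (agree (suc j) (s≤s z≤n)) (there j∈p)))

-- Decomposition at the pivot i of p' ≻ₛ p, with gaps offset by g in p and g' in p':
-- A and B are the gaps above i, x is the gap of i in p, y counts the non-elements of p'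
-- above i; below i both subsets equal suffix, whose gaps start from x resp. suc y.
record RevlexSplit {n} (g g' : ℕ) (p p' : Subset n) : Set where
  field
    A B : List ℕ
    x y : ℕ
    {len} : ℕ
    suffix : Subset len
    gaps-p  : gapsFrom g p ≡ A ++ x ∷ gapsFrom x suffix
    gaps-p' : gapsFrom g' p' ≡ B ++ gapsFrom (suc y) suffix
    A≤x : All (_≤ x) A
    B≤y : All (_≤ y) B
    g≤x : g ≤ x
    g'≤y : g' ≤ y
    sizes : ∣ p ∣ + x + g' ≡ suc (∣ p' ∣ + y + g)

revlexSplit : ∀ {n} g g' (p p' : Subset n) → p' ≻ₛ p → RevlexSplit g g' p p'
revlexSplit g g' (true ∷ p) (true ∷ p') (zero , _ , zero∉p' , _) = contradiction here zero∉p'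
revlexSplit g g' (true ∷ p) (false ∷ p') (zero , _ , _ , agree) with refl ← agree-tail agree =
  record { A = [] ; B = [] ; x = g ; y = g' ; suffix = p ; gaps-p = refl ; gaps-p' = refl
         ; A≤x = [] ; B≤y = [] ; g≤x = ≤-refl ; g'≤y = ≤-refl
         ; sizes = cong suc (xy∙z≈xz∙y ∣ p ∣ g g') }
revlexSplit g g' (true ∷ p) (true ∷ p') (suc i , i∈p , i∉p' , agree)
  with r ← revlexSplit g g' p p' (≻ₛ-tail i i∈p i∉p' agree) = record
  { A = g ∷ A ; B = g' ∷ B ; x = x ; y = y ; suffix = suffix
  ; gaps-p = cong (g ∷_) gaps-p ; gaps-p' = cong (g' ∷_) gaps-p'
  ; A≤x = g≤x ∷ A≤x ; B≤y = g'≤y ∷ B≤y ; g≤x = g≤x ; g'≤y = g'≤y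
  ; sizes = cong suc sizes }
  where open RevlexSplit r
revlexSplit g g' (true ∷ p) (false ∷ p') (suc i , i∈p , i∉p' , agree)
  with r ← revlexSplit g (suc g') p p' (≻ₛ-tail i i∈p i∉p' agree) = record
  { A = g ∷ A ; B = B ; x = x ; y = y ; suffix = suffix
  ; gaps-p = cong (g ∷_) gaps-p ; gaps-p' = gaps-p'
  ; A≤x = g≤x ∷ A≤x ; B≤y = B≤y ; g≤x = g≤x ; g'≤y = <⇒≤ g'≤y
  ; sizes = trans (sym (+-suc (∣ p ∣ + x) g')) sizes }
  where open RevlexSplit r
revlexSplit g g' (false ∷ p) (true ∷ p') (suc i , i∈p , i∉p' , agree)
  with r ← revlexSplit (suc g) g' p p' (≻ₛ-tail i i∈p i∉p' agree) = record
  { A = A ; B = g' ∷ B ; x = x ; y = y ; suffix = suffix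
  ; gaps-p = gaps-p ; gaps-p' = cong (g' ∷_) gaps-p'
  ; A≤x = A≤x ; B≤y = g'≤y ∷ B≤y ; g≤x = <⇒≤ g≤x ; g'≤y = g'≤y
  ; sizes = trans sizes (cong suc (+-suc (∣ p' ∣ + y) g)) }
  where open RevlexSplit r
revlexSplit g g' (false ∷ p) (false ∷ p') (suc i , i∈p , i∉p' , agree)
  with r ← revlexSplit (suc g) (suc g') p p' (≻ₛ-tail i i∈p i∉p' agree) = record
  { A = A ; B = B ; x = x ; y = y ; suffix = suffix
  ; gaps-p = gaps-p ; gaps-p' = gaps-p'
  ; A≤x = A≤x ; B≤y = B≤y ; g≤x = <⇒≤ g≤x ; g'≤y = <⇒≤ g'≤y
  ; sizes = suc-injective
      (trans (sym (+-suc (∣ p ∣ + x) g')) (trans sizes (cong suc (+-suc (∣ p' ∣ + y) g)))) }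
  where open RevlexSplit r

record PivotGaps {N} (m : ℕ) (τ τ' : Subset N) : Set where
  field
    k : Fin m
    A B C : List ℕ
    gaps-τ  : gapsFrom 0 τ ≡ A ++ suc (toℕ k) ∷ C
    gaps-τ' : gapsFrom 0 τ' ≡ B ++ C
    A≤k : All (_≤ suc (toℕ k)) A
    B≤k : All (_≤ toℕ k) B

pivotGaps : ∀ {N} (τ τ' : Subset N) → ∣ τ' ∣ ≡ ∣ τ ∣ → τ' ≻ₛ τ → PivotGaps (N ∸ ∣ τ ∣) τ τ'
pivotGaps {N} τ τ' ∣τ'∣≡∣τ∣ τ'≻τ = record
  { k = k ; A = A ; B = B ; C = gapsFrom (suc (toℕ k)) suffix
  ; gaps-τ  = trans gaps-p (cong (λ z → A ++ z ∷ gapsFrom z suffix) x≡suc-k)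
  ; gaps-τ' = trans gaps-p' (cong (λ z → B ++ gapsFrom (suc z) suffix) (sym k≡y))
  ; A≤k = subst (λ z → All (_≤ z) A) x≡suc-k A≤x
  ; B≤k = subst (λ z → All (_≤ z) B) (sym k≡y) B≤y }
  where
  open RevlexSplit (revlexSplit 0 0 τ τ' τ'≻τ)
  x≡suc-y : x ≡ suc y
  x≡suc-y = +-cancelˡ-≡ ∣ τ ∣ x (suc y) (begin
    ∣ τ ∣ + x            ≡⟨ sym (+-identityʳ _) ⟩
    ∣ τ ∣ + x + 0        ≡⟨ sizes ⟩
    suc (∣ τ' ∣ + y + 0) ≡⟨ cong (λ s → suc (s + y + 0)) ∣τ'∣≡∣τ∣ ⟩
    suc (∣ τ ∣ + y + 0)  ≡⟨ cong suc (+-identityʳ _) ⟩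
    suc (∣ τ ∣ + y)      ≡⟨ sym (+-suc ∣ τ ∣ y) ⟩
    ∣ τ ∣ + suc y        ∎)
    where open ≡-Reasoning
  x≤∣∁τ∣ : x ≤ ∣ ∁ τ ∣
  x≤∣∁τ∣ = All.head (++⁻ʳ A (subst (All (_≤ ∣ ∁ τ ∣)) gaps-p (gapsFrom-≤ 0 τ)))
  y<m : y < N ∸ ∣ τ ∣
  y<m = subst₂ _≤_ x≡suc-y (∣∁p∣≡n∸∣p∣ τ) x≤∣∁τ∣
  k : Fin (N ∸ ∣ τ ∣)
  k = fromℕ< y<m
  k≡y : toℕ k ≡ y
  k≡y = toℕ-fromℕ< y<m
  x≡suc-k : x ≡ suc (toℕ k)
  x≡suc-k = trans x≡suc-y (cong suc (sym k≡y))

lemma6p1 : (N a : ℕ) → 1 ≤ a → a ≤ N → (τ τ' : Subset N) → ∣ τ ∣ ≡ a → ∣ τ' ∣ ≡ a →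
    τ' ≻ₛ τ → deg (φ N a τ') ≤ deg (φ N a τ) →
    Σ (Monomial (N ∸ a)) λ μ'' → (μ'' ∣ₘ φ N a τ) × (deg μ'' ≡ deg (φ N a τ')) × (φ N a τ' ⪰ₘ μ'')
lemma6p1 N .(∣ τ ∣) _ _ τ τ' refl ∣τ'∣≡∣τ∣ τ'≻τ deg≤ =
  revlex-divisor (monomial A) (monomial B) (monomial C) k φ-τ φ-τ'
    (λ j → monomial-vanishes A A≤k j) (λ j → monomial-vanishes B B≤k j) deg≤
  where
  open PivotGaps (pivotGaps τ τ' ∣τ'∣≡∣τ∣ τ'≻τ)
  φ-τ : ∀ j → φ N ∣ τ ∣ τ j ≡ (monomial A *ₘ (var k *ₘ monomial C)) j
  φ-τ j = trans (monomial-phiIndices τ j)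
    (trans (cong (λ L → monomial L j) gaps-τ) (monomial-++-var A k C j))
  φ-τ' : ∀ j → φ N ∣ τ ∣ τ' j ≡ (monomial B *ₘ monomial C) j
  φ-τ' j = trans (monomial-phiIndices τ' j)
    (trans (cong (λ L → monomial L j) gaps-τ') (monomial-++ B C j))
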